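{- An unbalanced composition $C$ is cyclic if and only if $\mathrm{eq}(C)$ is cyclic.
   Context: A composition of $n$ is a tuple $(a_1,\ldots,a_k)$ of positive integers with sum $n$. Its associated reverse layered permutation is, in one-line notation, $(n-a_1+1)\cdots(n)\,(n-a_1-a_2+1)\cdots(n-a_1)\cdots(1)\cdots(a_k)$ (values split into consecutive blocks of sizes $a_1,\ldots,a_k$, blocks in decreasing order of values, each block increasing). The composition is cyclic if this permutation is a single $n$-cycle. It is balanced if some prefix has sum $n/2$, and unbalanced otherwise. For unbalanced $C$, the dividing index is the $i$ with $a_1+\cdots+a_{i-1}<n/2<a_1+\cdots+a_i$. The nearly-equal division of $C$ is $((a_1,\ldots,a_i),(a_{i+1},\ldots,a_k))$ if $a_1+\cdots+a_{i-1}\le a_{i+1}+\cdots+a_k$, and $((a_1,\ldots,a_{i-1}),(a_i,\ldots,a_k))$ otherwise. If the nearly-equal division is $((a_1,\ldots,a_j),(a_{j+1},\ldots,a_k))$, the unequalness is $U(C)=\left|\sum_{\ell=1}^j a_\ell-\sum_{\ell=j+1}^k a_\ell\right|$ and the equalization is the composition $\mathrm{eq}(C)=(a_1,\ldots,a_j,U(C),a_{j+1},\ldots,a_k)$ of $n+U(C)$. -}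

module Defs where

open import Data.Nat using (ℕ; zero; suc; _+_; _*_; _∸_; _≤_; _<_; _<ᵇ_; _≤ᵇ_; ∣_-_∣)
open import Data.Bool using (if_then_else_)
open import Data.List using (List; []; _∷_; _++_; map; take; drop; length)
open import Data.Nat.ListAction using (sum)
open import Data.Product using (∃; _×_)
open import Relation.Binary.PropositionalEquality using (_≡_)
open import Relation.Nullary using (¬_)

-- A composition is a list of positive naturals (positivity is a hypothesis
-- stated separately with All); its n is  sum C.

upTo1 : ℕ → List ℕ
upTo1 zero = []
upTo1 (suc a) = upTo1 a ++ (suc a ∷ [])

-- one-line notation of the reverse layered permutation of (a₁,…,a_k):
-- block i consists of the values  (a_{i+1}+…+a_k)+1, …, (a_i+…+a_k), increasing.
oneLine : List ℕ → List ℕ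
oneLine [] = []
oneLine (a ∷ as) = map (_+ sum as) (upTo1 a) ++ oneLine as

-- 0-indexed list lookup with default 0
nth : List ℕ → ℕ → ℕ
nth [] _ = 0
nth (x ∷ xs) zero = x
nth (x ∷ xs) (suc i) = nth xs i

-- the permutation as a map on positions 1..n:  σ(p) = p-th entry of the one-line notation
revLayered : List ℕ → ℕ → ℕ
revLayered C p = nth (oneLine C) (p ∸ 1)

iter : (ℕ → ℕ) → ℕ → ℕ → ℕ
iter f zero x = x
iter f (suc k) x = f (iter f k x)

-- cyclic: the permutation of {1,…,n} (n = sum C) is a single n-cycle, i.e.
-- it has exactly one orbit: any element of {1,…,n} reaches any other.
Cyclic : List ℕ → Set
Cyclic C = ∀ x y → 1 ≤ x → x ≤ sum C → 1 ≤ y → y ≤ sum C →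
           ∃ λ k → iter (revLayered C) k x ≡ y

-- balanced: some prefix (a₁,…,a_j), 0 ≤ j ≤ k, has sum n/2, i.e. 2·(prefix sum) = n
Balanced : List ℕ → Set
Balanced C = ∃ λ j → j ≤ length C × 2 * sum (take j C) ≡ sum C

Unbalanced : List ℕ → Set
Unbalanced C = ¬ Balanced C

-- dividing index (1-based): the least i with n < 2·(a₁+…+a_i); for an unbalanced
-- composition this is the unique i with a₁+…+a_{i-1} < n/2 < a₁+…+a_i.
divAux : List ℕ → ℕ → ℕ → ℕ
divAux [] acc n = 0
divAux (a ∷ as) acc n = if n <ᵇ 2 * (acc + a) then 1 else suc (divAux as (acc + a) n)

dividingIndex : List ℕ → ℕ
dividingIndex C = divAux C 0 (sum C)

-- j such that the nearly-equal division is ((a₁,…,a_j),(a_{j+1},…,a_k))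
divisionPoint : List ℕ → ℕ
divisionPoint C =
  let i = dividingIndex C in
  if sum (take (i ∸ 1) C) ≤ᵇ sum (drop i C) then i else i ∸ 1

unequalness : List ℕ → ℕ
unequalness C = let j = divisionPoint C in ∣ sum (take j C) - sum (drop j C) ∣

equalization : List ℕ → List ℕ
equalization C = let j = divisionPoint C in take j C ++ (unequalness C ∷ drop j C)

module Submission where

-- Write C = L ++ R for the nearly-equal division, l = sum L, r = sum R and
-- U = ∣ l - r ∣, so that eq(C) = L ++ U ∷ R.  Both reverse layered permutations
-- are skew sums: f = σ ⊖ τ on {1,…,l+r} and g = σ ⊖ id_U ⊖ τ on {1,…,l+U+r},
-- where σ, τ are the reverse layered permutations of L and R.  Embed
-- {1,…,l+r} into {1,…,l+U+r} by φ p = p (p ≤ l) and φ p = p + U (p > l); the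
-- positions l+1,…,l+U of the inserted block are the fresh points.  Because U
-- is exactly the difference of l and r, every arc p ↦ f p of f becomes either
-- the arc φ p ↦ φ (f p) of g or a detour φ p ↦ u ↦ φ (f p) through a single
-- fresh point u.  So f is the first-return map of g on the image of φ, and the
-- abstract module FirstReturn shows that such a pair is cyclic simultaneously.
--
-- The theorem follows for every split C = L ++ R.

open import Defs
open import Data.Nat using (ℕ; zero; suc; _+_; _∸_; _≤_; _<_; _≤?_; z≤n; s≤s; ∣_-_∣)
open import Data.Nat.Properties
open import Data.Nat.Tactic.RingSolver using (solve-∀)
open import Data.Nat.ListAction using (sum)
open import Data.Nat.ListAction.Properties using (sum-++)
open import Data.List using (List; []; _∷_; _++_; map; length; take; drop)
open import Data.List.Properties using (length-++; length-map; take++drop≡id)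
open import Data.List.Relation.Unary.All using (All)
open import Data.Product using (_×_; _,_; ∃; ∃₂; proj₁; proj₂)
open import Data.Sum using (_⊎_; inj₁; inj₂)
open import Data.Empty using (⊥-elim)
open import Relation.Nullary using (¬_; yes; no)
open import Relation.Binary.PropositionalEquality
  using (_≡_; refl; sym; trans; cong; subst; subst₂; module ≡-Reasoning)

open ≡-Reasoning

iter-+ : ∀ (f : ℕ → ℕ) a b x → iter f (a + b) x ≡ iter f a (iter f b x)
iter-+ f zero    b x = refl
iter-+ f (suc a) b x = cong f (iter-+ f a b x)

iter-suc : ∀ (f : ℕ → ℕ) k x → iter f (suc k) x ≡ iter f k (f x)
iter-suc f zero    x = refl
iter-suc f (suc k) x = cong f (iter-suc f k x)

positive : ∀ {x} → 1 ≤ x → ∃ λ t → x ≡ suc t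
positive {suc t} _ = t , refl

InRange : ℕ → ℕ → Set
InRange n x = 1 ≤ x × x ≤ n

-- f has a single orbit on {1,…,n};  Cyclic C unfolds to IsCyclicOn (revLayered C) (sum C)
IsCyclicOn : (ℕ → ℕ) → ℕ → Set
IsCyclicOn f n = ∀ x y → 1 ≤ x → x ≤ n → 1 ≤ y → y ≤ n → ∃ λ k → iter f k x ≡ y

iter-range : ∀ {f n} → (∀ p → InRange n p → InRange n (f p)) →
             ∀ k p → InRange n p → InRange n (iter f k p)
iter-range f-range zero    p rp = rp
iter-range f-range (suc k) p rp = f-range _ (iter-range f-range k p rp)

-- a cyclic map is onto its domain: the predecessor of y is the point just before y on its orbit
cyclic-onto : ∀ {f n} → (∀ p → InRange n p → InRange n (f p)) →
              IsCyclicOn f n → ∀ y → InRange n y → ∃ λ x → InRange n x × f x ≡ y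
cyclic-onto {f} {n} f-range cyc y (1≤y , y≤n) with f-range y (1≤y , y≤n)
... | (1≤fy , fy≤n) with cyc (f y) y 1≤fy fy≤n 1≤y y≤n
... | k , fᵏfy≡y = iter f k y , iter-range f-range k y (1≤y , y≤n) , trans (iter-suc f k y) fᵏfy≡y

data Split (a : ℕ) : ℕ → Set where
  below  : ∀ {i} → i < a → Split a i
  beyond : ∀ j → Split a (a + j)

split : ∀ a i → Split a i
split zero    i       = beyond i
split (suc a) zero    = below (s≤s z≤n)
split (suc a) (suc i) with split a i
... | below i<a = below (s≤s i<a)
... | beyond j  = beyond j

nth-++ˡ : ∀ xs ys i → i < length xs → nth (xs ++ ys) i ≡ nth xs i
nth-++ˡ (x ∷ xs) ys zero    _         = refl
nth-++ˡ (x ∷ xs) ys (suc i) (s≤s i<n) = nth-++ˡ xs ys i i<n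

nth-++ʳ : ∀ xs ys j → nth (xs ++ ys) (length xs + j) ≡ nth ys j
nth-++ʳ []       ys j = refl
nth-++ʳ (x ∷ xs) ys j = nth-++ʳ xs ys j

nth-map : ∀ f xs i → i < length xs → nth (map f xs) i ≡ f (nth xs i)
nth-map f (x ∷ xs) zero    _         = refl
nth-map f (x ∷ xs) (suc i) (s≤s i<n) = nth-map f xs i i<n

length-upTo1 : ∀ a → length (upTo1 a) ≡ a
length-upTo1 zero    = refl
length-upTo1 (suc a) = begin
  length (upTo1 a ++ suc a ∷ [])  ≡⟨ length-++ (upTo1 a) ⟩
  length (upTo1 a) + 1            ≡⟨ cong (_+ 1) (length-upTo1 a) ⟩
  a + 1                           ≡⟨ +-comm a 1 ⟩
  suc a                           ∎

nth-upTo1 : ∀ a i → i < a → nth (upTo1 a) i ≡ suc i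
nth-upTo1 (suc a) i (s≤s i≤a) with m≤n⇒m<n∨m≡n i≤a
... | inj₁ i<a = trans (nth-++ˡ (upTo1 a) _ i (subst (i <_) (sym (length-upTo1 a)) i<a))
                       (nth-upTo1 a i i<a)
... | inj₂ refl = begin
  nth (upTo1 i ++ suc i ∷ []) i                     ≡⟨ cong (nth (upTo1 i ++ suc i ∷ [])) i≡len ⟩
  nth (upTo1 i ++ suc i ∷ []) (length (upTo1 i) + 0) ≡⟨ nth-++ʳ (upTo1 i) (suc i ∷ []) 0 ⟩
  suc i                                             ∎
  where
  i≡len : i ≡ length (upTo1 i) + 0
  i≡len = sym (trans (+-identityʳ _) (length-upTo1 i))

length-block : ∀ a s → length (map (_+ s) (upTo1 a)) ≡ a
length-block a s = trans (length-map (_+ s) (upTo1 a)) (length-upTo1 a)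

nth-oneLine-head : ∀ a as i → i < a → nth (oneLine (a ∷ as)) i ≡ suc i + sum as
nth-oneLine-head a as i i<a = begin
  nth (map (_+ sum as) (upTo1 a) ++ oneLine as) i
    ≡⟨ nth-++ˡ (map (_+ sum as) (upTo1 a)) _ i (subst (i <_) (sym (length-block a (sum as))) i<a) ⟩
  nth (map (_+ sum as) (upTo1 a)) i
    ≡⟨ nth-map (_+ sum as) (upTo1 a) i (subst (i <_) (sym (length-upTo1 a)) i<a) ⟩
  nth (upTo1 a) i + sum as
    ≡⟨ cong (_+ sum as) (nth-upTo1 a i i<a) ⟩
  suc i + sum as ∎

nth-oneLine-tail : ∀ a as j → nth (oneLine (a ∷ as)) (a + j) ≡ nth (oneLine as) j
nth-oneLine-tail a as j = begin
  nth (map (_+ sum as) (upTo1 a) ++ oneLine as) (a + j)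
    ≡⟨ cong (λ k → nth (map (_+ sum as) (upTo1 a) ++ oneLine as) (k + j)) (sym (length-block a (sum as))) ⟩
  nth (map (_+ sum as) (upTo1 a) ++ oneLine as) (length (map (_+ sum as) (upTo1 a)) + j)
    ≡⟨ nth-++ʳ (map (_+ sum as) (upTo1 a)) (oneLine as) j ⟩
  nth (oneLine as) j ∎

nth-oneLine-range : ∀ X i → i < sum X → InRange (sum X) (nth (oneLine X) i)
nth-oneLine-range (a ∷ as) i i<n with split a i
... | below i<a rewrite nth-oneLine-head a as i i<a = s≤s z≤n , +-monoˡ-≤ (sum as) i<a
... | beyond j rewrite nth-oneLine-tail a as j with nth-oneLine-range as j (+-cancelˡ-< a j (sum as) i<n)
...   | (1≤v , v≤s) = 1≤v , ≤-trans v≤s (m≤n+m (sum as) a)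

-- σ_{L ++ M} is a skew sum: on the first sum L positions it is σ_L shifted up by sum M …
nth-oneLine-++ˡ : ∀ L M i → i < sum L → nth (oneLine (L ++ M)) i ≡ nth (oneLine L) i + sum M
nth-oneLine-++ˡ (a ∷ as) M i i<n with split a i
... | below i<a = begin
  nth (oneLine (a ∷ as ++ M)) i    ≡⟨ nth-oneLine-head a (as ++ M) i i<a ⟩
  suc i + sum (as ++ M)            ≡⟨ cong (suc i +_) (sum-++ as M) ⟩
  suc i + (sum as + sum M)         ≡⟨ sym (+-assoc (suc i) (sum as) (sum M)) ⟩
  suc i + sum as + sum M           ≡⟨ cong (_+ sum M) (sym (nth-oneLine-head a as i i<a)) ⟩
  nth (oneLine (a ∷ as)) i + sum M ∎
... | beyond j = begin
  nth (oneLine (a ∷ as ++ M)) (a + j)    ≡⟨ nth-oneLine-tail a (as ++ M) j ⟩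
  nth (oneLine (as ++ M)) j              ≡⟨ nth-oneLine-++ˡ as M j (+-cancelˡ-< a j (sum as) i<n) ⟩
  nth (oneLine as) j + sum M             ≡⟨ cong (_+ sum M) (sym (nth-oneLine-tail a as j)) ⟩
  nth (oneLine (a ∷ as)) (a + j) + sum M ∎

-- … and on the remaining positions it is σ_M
nth-oneLine-++ʳ : ∀ L M q → nth (oneLine (L ++ M)) (sum L + q) ≡ nth (oneLine M) q
nth-oneLine-++ʳ []       M q = refl
nth-oneLine-++ʳ (a ∷ as) M q = begin
  nth (oneLine (a ∷ as ++ M)) (a + sum as + q)   ≡⟨ cong (nth (oneLine (a ∷ as ++ M))) (+-assoc a (sum as) q) ⟩
  nth (oneLine (a ∷ as ++ M)) (a + (sum as + q)) ≡⟨ nth-oneLine-tail a (as ++ M) (sum as + q) ⟩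
  nth (oneLine (as ++ M)) (sum as + q)           ≡⟨ nth-oneLine-++ʳ as M q ⟩
  nth (oneLine M) q                              ∎

-- First-return maps.  f acts on {1,…,n}, g on {1,…,m}, and φ embeds the
-- former into the latter; every point of {1,…,m} outside the image of φ is
-- Fresh.  If each arc p ↦ f p is realized in g either directly or through
-- exactly one fresh point, and every fresh point lies on such a detour, then
-- f is cyclic iff g is.

module FirstReturn
  (n m : ℕ) (f g φ : ℕ → ℕ) (Fresh : ℕ → Set)
  (f-range     : ∀ p → InRange n p → InRange n (f p))
  (φ-range     : ∀ p → InRange n p → InRange m (φ p))
  (φ-injective : ∀ p q → φ p ≡ φ q → p ≡ q)
  (φ-notFresh  : ∀ p → ¬ Fresh (φ p))
  (cover       : ∀ y → InRange m y → (∃ λ p → InRange n p × φ p ≡ y) ⊎ Fresh y)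
  (step        : ∀ p → InRange n p →
                 g (φ p) ≡ φ (f p) ⊎ (Fresh (g (φ p)) × g (g (φ p)) ≡ φ (f p)))
  (entered     : ∀ u → Fresh u → ∃ λ y → InRange n y ×
                 (∀ p → InRange n p → f p ≡ y → g (φ p) ≡ u))
  where

  lift : ∀ k p → InRange n p → ∃ λ k′ → iter g k′ (φ p) ≡ φ (iter f k p)
  lift zero    p rp = 0 , refl
  lift (suc k) p rp with lift k p rp
  ... | k′ , gᵏ′≡ with step (iter f k p) (iter-range f-range k p rp)
  ...   | inj₁ direct       = suc k′ , trans (cong g gᵏ′≡) direct
  ...   | inj₂ (_ , detour) = suc (suc k′) , trans (cong (λ z → g (g z)) gᵏ′≡) detour

  descent : ∀ k p → InRange n p →
    (∃ λ j → iter g k (φ p) ≡ φ (iter f j p)) ⊎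
    (∃ λ j → Fresh (iter g k (φ p)) × g (iter g k (φ p)) ≡ φ (iter f j p))
  descent zero    p rp = inj₁ (0 , refl)
  descent (suc k) p rp with descent k p rp
  ... | inj₂ (j , _ , g≡) = inj₁ (j , g≡)
  ... | inj₁ (j , gᵏ≡) with step (iter f j p) (iter-range f-range j p rp)
  ...   | inj₁ direct = inj₁ (suc j , trans (cong g gᵏ≡) direct)
  ...   | inj₂ (fresh , detour) =
          inj₂ (suc j , subst Fresh (cong g (sym gᵏ≡)) fresh , trans (cong (λ z → g (g z)) gᵏ≡) detour)

  -- a g-path from φ x to φ y never stops on a fresh point, so it descends to an f-path
  backward : IsCyclicOn g m → IsCyclicOn f n
  backward cyc x y 1≤x x≤n 1≤y y≤n with φ-range x (1≤x , x≤n) | φ-range y (1≤y , y≤n)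
  ... | (1≤φx , φx≤m) | (1≤φy , φy≤m) with cyc (φ x) (φ y) 1≤φx φx≤m 1≤φy φy≤m
  ... | k , gᵏφx≡φy with descent k x (1≤x , x≤n)
  ...   | inj₁ (j , gᵏ≡) = j , φ-injective _ _ (trans (sym gᵏ≡) gᵏφx≡φy)
  ...   | inj₂ (_ , fresh , _) = ⊥-elim (φ-notFresh y (subst Fresh gᵏφx≡φy fresh))

  module _ (cyc : IsCyclicOn f n) where

    fresh-detour : ∀ u → Fresh u → ∃ λ x → InRange n x × g (φ x) ≡ u × g u ≡ φ (f x)
    fresh-detour u fresh with entered u fresh
    ... | y , ry , into-u with cyclic-onto f-range cyc y ry
    ...   | x , rx , fx≡y with into-u x rx fx≡y | step x rx
    ...     | gφx≡u | inj₁ direct = ⊥-elim (φ-notFresh (f x) (subst Fresh (trans (sym gφx≡u) direct) fresh))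
    ...     | gφx≡u | inj₂ (_ , detour) = x , rx , gφx≡u , subst (λ z → g z ≡ φ (f x)) gφx≡u detour

    enter : ∀ y → InRange m y → ∃₂ λ x k → InRange n x × iter g k y ≡ φ x
    enter y ry with cover y ry
    ... | inj₁ (p , rp , φp≡y) = p , 0 , rp , sym φp≡y
    ... | inj₂ fresh with fresh-detour y fresh
    ...   | x , rx , _ , gy≡ = f x , 1 , f-range x rx , gy≡

    leave : ∀ y → InRange m y → ∃₂ λ x k → InRange n x × iter g k (φ x) ≡ y
    leave y ry with cover y ry
    ... | inj₁ (p , rp , φp≡y) = p , 0 , rp , φp≡y
    ... | inj₂ fresh with fresh-detour y fresh
    ...   | x , rx , gφx≡y , _ = x , 1 , rx , gφx≡y

    -- enter the image, follow a lifted f-path, then leave towards the target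
    forward : IsCyclicOn g m
    forward y₁ y₂ 1≤y₁ y₁≤m 1≤y₂ y₂≤m with enter y₁ (1≤y₁ , y₁≤m) | leave y₂ (1≤y₂ , y₂≤m)
    ... | x₁ , k₁ , (1≤x₁ , x₁≤n) , gᵏ¹y₁≡ | x₂ , k₂ , (1≤x₂ , x₂≤n) , gᵏ²≡y₂
      with cyc x₁ x₂ 1≤x₁ x₁≤n 1≤x₂ x₂≤n
    ...   | k , fᵏx₁≡x₂ with lift k x₁ (1≤x₁ , x₁≤n)
    ...     | k′ , gᵏ′≡ = k₂ + (k′ + k₁) , (begin
      iter g (k₂ + (k′ + k₁)) y₁          ≡⟨ iter-+ g k₂ (k′ + k₁) y₁ ⟩
      iter g k₂ (iter g (k′ + k₁) y₁)     ≡⟨ cong (iter g k₂) (iter-+ g k′ k₁ y₁) ⟩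
      iter g k₂ (iter g k′ (iter g k₁ y₁)) ≡⟨ cong (λ z → iter g k₂ (iter g k′ z)) gᵏ¹y₁≡ ⟩
      iter g k₂ (iter g k′ (φ x₁))        ≡⟨ cong (iter g k₂) gᵏ′≡ ⟩
      iter g k₂ (φ (iter f k x₁))         ≡⟨ cong (λ z → iter g k₂ (φ z)) fᵏx₁≡x₂ ⟩
      iter g k₂ (φ x₂)                    ≡⟨ gᵏ²≡y₂ ⟩
      y₂                                  ∎)

∣-∣-fills-gap : ∀ l r → (l + ∣ l - r ∣ ≡ r) ⊎ (r + ∣ l - r ∣ ≡ l)
∣-∣-fills-gap l r with l ≤? r
... | yes l≤r = inj₁ (trans (cong (l +_) (m≤n⇒∣m-n∣≡n∸m l≤r)) (m+[n∸m]≡n l≤r))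
... | no  l≰r = inj₂ (trans (cong (r +_) (m≤n⇒∣n-m∣≡n∸m r≤l)) (m+[n∸m]≡n r≤l))
  where
  r≤l : r ≤ l
  r≤l = ≰⇒≥ l≰r

-- Inserting a block.  f is the skew sum σ ⊖ τ of maps σ on {1,…,l} and τ on
-- {1,…,r} (values of σ shifted up by r), and g is σ ⊖ id_U ⊖ τ; the equations
-- below describe them position by position (0-based offsets i, t, q).
-- When U fills the gap between l and r, g arises from f by detours as in
-- FirstReturn, so f and g are cyclic simultaneously.

module InsertBlock
  (l r U : ℕ) (σ τ f g : ℕ → ℕ)
  (σ-range  : ∀ i → i < l → InRange l (σ i))
  (τ-range  : ∀ q → q < r → InRange r (τ q))
  (f-left   : ∀ i → i < l → f (suc i) ≡ σ i + r)
  (f-right  : ∀ q → q < r → f (suc (l + q)) ≡ τ q)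
  (g-left   : ∀ i → i < l → g (suc i) ≡ σ i + (U + r))
  (g-middle : ∀ t → t < U → g (suc (l + t)) ≡ suc t + r)
  (g-right  : ∀ q → q < r → g (suc (l + (U + q))) ≡ τ q)
  where

  n m : ℕ
  n = l + r
  m = l + (U + r)

  data Position : ℕ → Set where
    left  : ∀ i → i < l → Position (suc i)
    right : ∀ q → q < r → Position (suc (l + q))

  position : ∀ p → InRange n p → Position p
  position (suc i) (_ , i<n) with split l i
  ... | below i<l = left i i<l
  ... | beyond q  = right q (+-cancelˡ-< l q r i<n)

  f-left-above : ∀ i → i < l → r < f (suc i)
  f-left-above i i<l with σ-range i i<l
  ... | (1≤σi , _) = subst (r <_) (sym (f-left i i<l)) (+-monoˡ-≤ r 1≤σi)

  f-right-below : ∀ q → q < r → f (suc (l + q)) ≤ r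
  f-right-below q q<r with τ-range q q<r
  ... | (_ , τq≤r) = subst (_≤ r) (sym (f-right q q<r)) τq≤r

  f-range : ∀ p → InRange n p → InRange n (f p)
  f-range p rp with position p rp
  ... | left i i<l with σ-range i i<l
  ...   | (1≤σi , σi≤l) rewrite f-left i i<l = ≤-trans 1≤σi (m≤m+n _ r) , +-monoˡ-≤ r σi≤l
  f-range p rp | right q q<r with τ-range q q<r
  ...   | (1≤τq , τq≤r) rewrite f-right q q<r = 1≤τq , ≤-trans τq≤r (m≤n+m r l)

  -- the embedding: the τ-part moves up by U to make room for the new block
  φ : ℕ → ℕ
  φ p with p ≤? l
  ... | yes _ = p
  ... | no  _ = p + U

  φ-low : ∀ p → p ≤ l → φ p ≡ p
  φ-low p p≤l with p ≤? l
  ... | yes _   = refl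
  ... | no  p≰l = ⊥-elim (p≰l p≤l)

  φ-high : ∀ p → l < p → φ p ≡ p + U
  φ-high p l<p with p ≤? l
  ... | yes p≤l = ⊥-elim (<⇒≱ l<p p≤l)
  ... | no  _   = refl

  φ-right : ∀ q → φ (suc (l + q)) ≡ suc (l + (U + q))
  φ-right q = trans (φ-high _ (s≤s (m≤m+n l q))) (shift l q U)
    where
    shift : ∀ l q U → suc (l + q) + U ≡ suc (l + (U + q))
    shift = solve-∀

  -- the positions of the inserted block
  Fresh : ℕ → Set
  Fresh u = l < u × u ≤ l + U

  fresh-form : ∀ u → Fresh u → ∃ λ t → t < U × u ≡ suc (l + t)
  fresh-form u (l<u , u≤l+U) =
    u ∸ suc l , +-cancelˡ-< l _ U (subst (_≤ l + U) u≡ u≤l+U) , u≡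
    where
    u≡ : u ≡ suc (l + (u ∸ suc l))
    u≡ = sym (m+[n∸m]≡n l<u)

  middle-fresh : ∀ t → t < U → Fresh (suc (l + t))
  middle-fresh t t<U = s≤s (m≤m+n l t) , +-monoʳ-< l t<U

  φ-range : ∀ p → InRange n p → InRange m (φ p)
  φ-range p (1≤p , p≤n) with p ≤? l
  ... | yes p≤l = 1≤p , ≤-trans p≤l (m≤m+n l _)
  ... | no  _   = ≤-trans 1≤p (m≤m+n p U) , subst (p + U ≤_) (regroup l r U) (+-monoˡ-≤ U p≤n)
    where
    regroup : ∀ l r U → l + r + U ≡ l + (U + r)
    regroup = solve-∀

  φ-injective : ∀ p q → φ p ≡ φ q → p ≡ q
  φ-injective p q φp≡φq with p ≤? l | q ≤? l
  ... | yes _   | yes _   = φp≡φq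
  ... | yes p≤l | no  q≰l = ⊥-elim (q≰l (≤-trans (m≤m+n q U) (subst (_≤ l) φp≡φq p≤l)))
  ... | no  p≰l | yes q≤l = ⊥-elim (p≰l (≤-trans (m≤m+n p U) (subst (_≤ l) (sym φp≡φq) q≤l)))
  ... | no  _   | no  _   = +-cancelʳ-≡ U p q φp≡φq

  φ-notFresh : ∀ p → ¬ Fresh (φ p)
  φ-notFresh p (l<φp , φp≤l+U) with p ≤? l
  ... | yes p≤l = <⇒≱ l<φp p≤l
  ... | no  p≰l = p≰l (+-cancelʳ-≤ U p l φp≤l+U)

  cover : ∀ y → InRange m y → (∃ λ p → InRange n p × φ p ≡ y) ⊎ Fresh y
  cover (suc i) (_ , i<m) with split l i
  ... | below i<l = inj₁ (suc i , (s≤s z≤n , ≤-trans i<l (m≤m+n l r)) , φ-low (suc i) i<l)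
  ... | beyond t with split U t
  ...   | below t<U = inj₂ (middle-fresh t t<U)
  ...   | beyond q  = inj₁ (suc (l + q) , (s≤s z≤n , +-monoʳ-< l q<r) , φ-right q)
    where
    q<r : q < r
    q<r = +-cancelˡ-< U q r (+-cancelˡ-< l (U + q) (U + r) i<m)

  g-φ-left : ∀ i → i < l → g (φ (suc i)) ≡ σ i + (U + r)
  g-φ-left i i<l = trans (cong g (φ-low (suc i) i<l)) (g-left i i<l)

  g-φ-right : ∀ q → q < r → g (φ (suc (l + q))) ≡ τ q
  g-φ-right q q<r = trans (cong g (φ-right q)) (g-right q q<r)

  stay-left : ∀ i → i < l → l < σ i + r → g (φ (suc i)) ≡ φ (f (suc i))
  stay-left i i<l l<σi+r = begin
    g (φ (suc i))     ≡⟨ g-φ-left i i<l ⟩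
    σ i + (U + r)     ≡⟨ regroup (σ i) U r ⟩
    σ i + r + U       ≡⟨ sym (φ-high _ l<σi+r) ⟩
    φ (σ i + r)       ≡⟨ cong φ (sym (f-left i i<l)) ⟩
    φ (f (suc i))     ∎
    where
    regroup : ∀ x U r → x + (U + r) ≡ x + r + U
    regroup = solve-∀

  stay-right : ∀ q → q < r → τ q ≤ l → g (φ (suc (l + q))) ≡ φ (f (suc (l + q)))
  stay-right q q<r τq≤l = begin
    g (φ (suc (l + q)))   ≡⟨ g-φ-right q q<r ⟩
    τ q                   ≡⟨ sym (φ-low _ τq≤l) ⟩
    φ (τ q)               ≡⟨ cong φ (sym (f-right q q<r)) ⟩
    φ (f (suc (l + q)))   ∎

  -- the two hypotheses of FirstReturn that depend on how l and r compare
  Step : ℕ → Set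
  Step p = g (φ p) ≡ φ (f p) ⊎ (Fresh (g (φ p)) × g (g (φ p)) ≡ φ (f p))

  Entered : ℕ → Set
  Entered u = ∃ λ y → InRange n y × (∀ p → InRange n p → f p ≡ y → g (φ p) ≡ u)

  -- l ≤ r: an arc of τ ending above l passes through its own endpoint, which is
  -- a fresh point, and g moves it up by U
  module Lower (l+U≡r : l + U ≡ r) where

    l≤r : l ≤ r
    l≤r = subst (l ≤_) l+U≡r (m≤m+n l U)

    τ-fresh : ∀ q → q < r → l < τ q → Fresh (τ q)
    τ-fresh q q<r l<τq = l<τq , subst (τ q ≤_) (sym l+U≡r) (proj₂ (τ-range q q<r))

    leave-block : ∀ u → Fresh u → g u ≡ φ u
    leave-block u fresh with fresh-form u fresh
    ... | t , t<U , refl = begin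
      g (suc (l + t))   ≡⟨ g-middle t t<U ⟩
      suc t + r         ≡⟨ cong (suc t +_) (sym l+U≡r) ⟩
      suc t + (l + U)   ≡⟨ regroup t l U ⟩
      suc (l + t) + U   ≡⟨ sym (φ-high _ (s≤s (m≤m+n l t))) ⟩
      φ (suc (l + t))   ∎
      where
      regroup : ∀ t l U → suc t + (l + U) ≡ suc (l + t) + U
      regroup = solve-∀

    step : ∀ p → InRange n p → Step p
    step p rp with position p rp
    ... | left i i<l = inj₁ (stay-left i i<l (≤-trans (s≤s l≤r) (+-monoˡ-≤ r (proj₁ (σ-range i i<l)))))
    ... | right q q<r with τ q ≤? l
    ...   | yes τq≤l = inj₁ (stay-right q q<r τq≤l)
    ...   | no  τq≰l = inj₂ (subst Fresh (sym (g-φ-right q q<r)) fresh , (begin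
      g (g (φ (suc (l + q))))  ≡⟨ cong g (g-φ-right q q<r) ⟩
      g (τ q)                  ≡⟨ leave-block (τ q) fresh ⟩
      φ (τ q)                  ≡⟨ cong φ (sym (f-right q q<r)) ⟩
      φ (f (suc (l + q)))      ∎))
      where
      fresh : Fresh (τ q)
      fresh = τ-fresh q q<r (≰⇒> τq≰l)

    entered : ∀ u → Fresh u → Entered u
    entered u (l<u , u≤l+U) = u , (≤-trans (s≤s z≤n) l<u , ≤-trans u≤r (m≤n+m r l)) , into-u
      where
      u≤r : u ≤ r
      u≤r = subst (u ≤_) l+U≡r u≤l+U
      into-u : ∀ p → InRange n p → f p ≡ u → g (φ p) ≡ u
      into-u p rp fp≡u with position p rp
      ... | left i i<l = ⊥-elim (<⇒≱ (f-left-above i i<l) (subst (_≤ r) (sym fp≡u) u≤r))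
      ... | right q q<r = trans (g-φ-right q q<r) (trans (sym (f-right q q<r)) fp≡u)

  -- r ≤ l: an arc of σ whose shifted endpoint x + r is at most l enters the new
  -- block at x + U + r, and g brings that fresh point down to x + r
  module Upper (r+U≡l : r + U ≡ l) where

    r≤l : r ≤ l
    r≤l = subst (r ≤_) r+U≡l (m≤m+n r U)

    -- the value σ i + U + r of g at the σ-position with σ i = t + 1 is the block position l + t + 1
    into-block : ∀ t → suc t + (U + r) ≡ suc (l + t)
    into-block t = trans (regroup t U r) (cong (λ z → suc (z + t)) r+U≡l)
      where
      regroup : ∀ t U r → suc t + (U + r) ≡ suc (r + U + t)
      regroup = solve-∀

    through-block : ∀ x → 1 ≤ x → x + r ≤ l → Fresh (x + (U + r)) × g (x + (U + r)) ≡ x + r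
    through-block x 1≤x x+r≤l with positive 1≤x
    ... | t , refl rewrite into-block t = middle-fresh t t<U , g-middle t t<U
      where
      t<U : t < U
      t<U = +-cancelʳ-≤ r (suc t) U (subst (suc t + r ≤_) (trans (sym r+U≡l) (+-comm r U)) x+r≤l)

    step : ∀ p → InRange n p → Step p
    step p rp with position p rp
    ... | right q q<r = inj₁ (stay-right q q<r (≤-trans (proj₂ (τ-range q q<r)) r≤l))
    ... | left i i<l with σ i + r ≤? l
    ...   | no  σi+r≰l = inj₁ (stay-left i i<l (≰⇒> σi+r≰l))
    ...   | yes σi+r≤l with through-block (σ i) (proj₁ (σ-range i i<l)) σi+r≤l
    ...     | fresh , g-through = inj₂ (subst Fresh (sym (g-φ-left i i<l)) fresh , (begin
      g (g (φ (suc i)))  ≡⟨ cong g (g-φ-left i i<l) ⟩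
      g (σ i + (U + r))  ≡⟨ g-through ⟩
      σ i + r            ≡⟨ sym (φ-low _ σi+r≤l) ⟩
      φ (σ i + r)        ≡⟨ cong φ (sym (f-left i i<l)) ⟩
      φ (f (suc i))      ∎))

    entered : ∀ u → Fresh u → Entered u
    entered u fresh with fresh-form u fresh
    ... | t , t<U , refl = suc t + r , (s≤s z≤n , y≤n) , into-u
      where
      y≤n : suc t + r ≤ l + r
      y≤n = +-monoˡ-≤ r (≤-trans t<U (subst (U ≤_) r+U≡l (m≤n+m U r)))
      into-u : ∀ p → InRange n p → f p ≡ suc t + r → g (φ p) ≡ suc (l + t)
      into-u p rp fp≡ with position p rp
      ... | right q q<r = ⊥-elim (<⇒≱ (s≤s (m≤n+m r t)) (subst (_≤ r) fp≡ (f-right-below q q<r)))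
      ... | left i i<l = begin
        g (φ (suc i))   ≡⟨ g-φ-left i i<l ⟩
        σ i + (U + r)   ≡⟨ cong (_+ (U + r)) σi≡ ⟩
        suc t + (U + r) ≡⟨ into-block t ⟩
        suc (l + t)     ∎
        where
        σi≡ : σ i ≡ suc t
        σi≡ = +-cancelʳ-≡ r (σ i) (suc t) (trans (sym (f-left i i<l)) fp≡)

  cyclic-iff : (l + U ≡ r) ⊎ (r + U ≡ l) →
               (IsCyclicOn f n → IsCyclicOn g m) × (IsCyclicOn g m → IsCyclicOn f n)
  cyclic-iff (inj₁ l+U≡r) = forward , backward
    where open FirstReturn n m f g φ Fresh f-range φ-range φ-injective φ-notFresh cover
                           (Lower.step l+U≡r) (Lower.entered l+U≡r)
  cyclic-iff (inj₂ r+U≡l) = forward , backward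
    where open FirstReturn n m f g φ Fresh f-range φ-range φ-injective φ-notFresh cover
                           (Upper.step r+U≡l) (Upper.entered r+U≡l)

cyclic-insert : ∀ L R → let U = ∣ sum L - sum R ∣ in
                (Cyclic (L ++ R) → Cyclic (L ++ U ∷ R)) × (Cyclic (L ++ U ∷ R) → Cyclic (L ++ R))
cyclic-insert L R =
  (λ cyc → subst (IsCyclicOn g) (sym sum-g) (to (subst (IsCyclicOn f) sum-f cyc))) ,
  (λ cyc → subst (IsCyclicOn f) (sym sum-f) (from (subst (IsCyclicOn g) sum-g cyc)))
  where
  l r U : ℕ
  l = sum L
  r = sum R
  U = ∣ l - r ∣
  f g : ℕ → ℕ
  f = revLayered (L ++ R)
  g = revLayered (L ++ U ∷ R)

  sum-f : sum (L ++ R) ≡ l + r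
  sum-f = sum-++ L R
  sum-g : sum (L ++ U ∷ R) ≡ l + (U + r)
  sum-g = sum-++ L (U ∷ R)

  -- position p + 1 of a reverse layered permutation holds entry p of its one-line notation
  g-middle : ∀ t → t < U → g (suc (l + t)) ≡ suc t + r
  g-middle t t<U = trans (nth-oneLine-++ʳ L (U ∷ R) t) (nth-oneLine-head U R t t<U)

  g-right : ∀ q → q < r → g (suc (l + (U + q))) ≡ nth (oneLine R) q
  g-right q _ = trans (nth-oneLine-++ʳ L (U ∷ R) (U + q)) (nth-oneLine-tail U R q)

  open InsertBlock l r U (nth (oneLine L)) (nth (oneLine R)) f g
         (nth-oneLine-range L) (nth-oneLine-range R)
         (nth-oneLine-++ˡ L R) (λ q _ → nth-oneLine-++ʳ L R q)
         (nth-oneLine-++ˡ L (U ∷ R)) g-middle g-right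
  to-from : (IsCyclicOn f (l + r) → IsCyclicOn g (l + (U + r))) ×
            (IsCyclicOn g (l + (U + r)) → IsCyclicOn f (l + r))
  to-from = cyclic-iff (∣-∣-fills-gap l r)
  to : IsCyclicOn f (l + r) → IsCyclicOn g (l + (U + r))
  to = proj₁ to-from
  from : IsCyclicOn g (l + (U + r)) → IsCyclicOn f (l + r)
  from = proj₂ to-from

-- Lemma 4.6.  The equalization inserts ∣ sum L - sum R ∣ between the halves of
-- the nearly-equal division C = L ++ R.
lemma4p6 : (C : List ℕ) → All (λ a → 0 < a) C → Unbalanced C →
           (Cyclic C → Cyclic (equalization C)) × (Cyclic (equalization C) → Cyclic C)
lemma4p6 C _ _ =
  (λ cyc → proj₁ (cyclic-insert L R) (subst Cyclic (sym C≡L++R) cyc)) ,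
  (λ cyc → subst Cyclic C≡L++R (proj₂ (cyclic-insert L R) cyc))
  where
  j : ℕ
  j = divisionPoint C
  L R : List ℕ
  L = take j C
  R = drop j C
  C≡L++R : L ++ R ≡ C
  C≡L++R = take++drop≡id j C
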